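{- Let $n\ge1$, let $\lambda$ be a partition contained in the staircase $\mathrm{stair}(n)=(n-1,n-2,\dots,1)$ (i.e. $\lambda_i\le n-i$ for all $i$, with $\lambda_i=0$ beyond its length), and let $P(\lambda)$ be the partial order on $[n]$ given by $a\prec b$ iff $a\le\lambda_{n+1-b}$. Then $P(\lambda)$ avoids the pattern $\mathbf{2}+\mathbf{1}+\mathbf{1}$ if and only if every corner of the shape of $\lambda$ is a corner of the shape of $\mathrm{stair}(n-1)$ or a corner of the shape of $\mathrm{stair}(n)$; equivalently, every corner $(r,c)$ of the shape of $\lambda$ satisfies $r-c\in\{1,2\}$.
   Context: The shape of a partition $\mu\subseteq\mathrm{stair}(n)$ is its Young diagram drawn in the south-west corner of an $n\times n$ grid: indexing rows $r=1,\dots,n$ from top to bottom and columns $c=1,\dots,n$ from left to right, the shape is the set of cells $(r,c)$ with $c\le\mu_{n+1-r}$. A corner of the shape is a cell $(r,c)$ of the shape such that neither $(r-1,c)$ nor $(r,c+1)$ lies in the shape (a north-east corner cell). The corners of the shape of $\mathrm{stair}(n)$ are the cells $(r,r-1)$ and those of $\mathrm{stair}(n-1)=(n-2,\dots,1)$ are the cells $(r,r-2)$. A poset avoids $\mathbf{2}+\mathbf{1}+\mathbf{1}$ if there are no four distinct elements $a,b,c,d$ with $a\prec b$ and with $c,d$ incomparable to each other and each incomparable to both $a$ and $b$. -}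

module Defs where

open import Data.Nat using (ℕ; zero; suc; _+_; _∸_; _≤_; _<_)
open import Data.Product using (_×_; Σ; ∃-syntax)
open import Data.Sum using (_⊎_)
open import Relation.Nullary using (¬_)
open import Relation.Binary.PropositionalEquality using (_≡_; _≢_)

-- A sequence of parts is a function ℕ → ℕ, read 1-based: μ i = μ_i for i ≥ 1.
-- The value μ 0 is never used by any definition below.
Parts : Set
Parts = ℕ → ℕ

IsPartitionInStair : ℕ → Parts → Set
IsPartitionInStair n μ =
  (∀ i → 1 ≤ i → μ (suc i) ≤ μ i) × (∀ i → 1 ≤ i → μ i ≤ n ∸ i)

InRange : ℕ → ℕ → Set
InRange n a = 1 ≤ a × a ≤ n

Prec : ℕ → Parts → ℕ → ℕ → Set
Prec n μ a b = a ≤ μ (suc n ∸ b)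

Incomparable : ℕ → Parts → ℕ → ℕ → Set
Incomparable n μ x y = ¬ Prec n μ x y × ¬ Prec n μ y x

-- P(λ) avoids 2+1+1: there are no four distinct elements a, b, c, d of [n]
-- with a ≺ b, c ∥ d, and each of c, d incomparable to both a and b.
Avoids2+1+1 : ℕ → Parts → Set
Avoids2+1+1 n μ =
  ¬ (Σ ℕ λ a → Σ ℕ λ b → Σ ℕ λ c → Σ ℕ λ d →
       (InRange n a × InRange n b × InRange n c × InRange n d) ×
       (a ≢ b × a ≢ c × a ≢ d × b ≢ c × b ≢ d × c ≢ d) ×
       Prec n μ a b × Incomparable n μ c d ×
       Incomparable n μ c a × Incomparable n μ c b ×
       Incomparable n μ d a × Incomparable n μ d b)

-- Shape of μ in the n × n grid (rows r top-to-bottom, columns c left-to-right):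
-- cells (r, c) with 1 ≤ r, c ≤ n and c ≤ μ_{n+1-r}.
InShape : ℕ → Parts → ℕ → ℕ → Set
InShape n μ r c = InRange n r × InRange n c × c ≤ μ (suc n ∸ r)

-- North-east corner: (r,c) in the shape, (r-1,c) and (r,c+1) not in the shape.
-- (For r = 1 the cell (0,c) lies outside the grid, hence not in the shape.)
IsCorner : ℕ → Parts → ℕ → ℕ → Set
IsCorner n μ r c =
  InShape n μ r c × ¬ InShape n μ (r ∸ 1) c × ¬ InShape n μ r (suc c)

stair : ℕ → Parts
stair n i = n ∸ i

-- Row r of the shape has length row r = μ_{n+1-r}; rows weakly lengthen downwards, row r ≤ r − 1,
-- and a ≺ b iff a ≤ row b.  A corner in row r sits at column c = row r with row (r − 1) < c.
-- If r ≥ c + 3, then c ≺ r while r − 2 and r − 1 are incomparable to each other and to c and r.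
-- Conversely, given a ≺ b and incomparable x > y, both incomparable to a and b, we get
-- row x < a ≤ row b < y; the first row r in (x, b] of length ≥ a has a corner in column
-- row r < y < x < r, so r − c ≥ 3.  Finally the corners of stair(n) and stair(n − 1) are
-- exactly the cells with r − c = 1 and r − c = 2.
module Submission where

open import Defs
open import Data.Nat using (ℕ; zero; suc; _+_; _∸_; _≤_; _<_; _≤′_; ≤′-refl; ≤′-step; z≤n; s≤s; _≤?_; _<?_)
open import Data.Nat.Properties
open import Data.Product using (_×_; _,_; proj₁; proj₂; ∃-syntax)
open import Data.Sum using (_⊎_; inj₁; inj₂; swap)
import Data.Sum as Sum
open import Data.Empty using (⊥-elim)
open import Relation.Nullary using (¬_; yes; no)
open import Relation.Nullary.Decidable using (decidable-stable)
open import Relation.Binary.PropositionalEquality using (_≡_; _≢_; refl; sym; trans; cong; subst; module ≡-Reasoning)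
open import Relation.Binary.Definitions using (tri<; tri≈; tri>)
open import Function using (_∘_)
open import Function.Bundles using (_⇔_; mk⇔; Equivalence)
import Function.Properties.Equivalence as ⇔

guarded-∀-cong : {A B C : ℕ → ℕ → Set} → (∀ {r c} → C r c → A r c ⇔ B r c) →
                 (∀ r c → C r c → A r c) ⇔ (∀ r c → C r c → B r c)
guarded-∀-cong A⇔B = mk⇔ (λ h r c k → Equivalence.to (A⇔B k) (h r c k))
                         (λ h r c k → Equivalence.from (A⇔B k) (h r c k))

crossing : (g : ℕ → ℕ) → ∀ {a x b} → x < b → g x < a → a ≤ g b →
           ∃[ r ] x ≤ r × r < b × g r < a × a ≤ g (suc r)
crossing g {a} {b = suc b} x<1+b gx<a a≤g[1+b] with g b <? a
... | yes gb<a = b , ≤-pred x<1+b , ≤-refl , gb<a , a≤g[1+b]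
... | no gb≮a with m≤n⇒m<n∨m≡n (≤-pred x<1+b)
...   | inj₂ refl = ⊥-elim (gb≮a gx<a)
...   | inj₁ x<b with crossing g x<b gx<a (≮⇒≥ gb≮a)
...     | r , x≤r , r<b , gr<a , a≤g[1+r] = r , x≤r , m≤n⇒m≤1+n r<b , gr<a , a≤g[1+r]

shallow⇒gap : ∀ {r c} → c < r → r ≤ 2 + c → r ≡ c + 1 ⊎ r ≡ c + 2
shallow⇒gap {zero}              {_}     ()
shallow⇒gap {suc zero}          {zero}  _ _ = inj₁ refl
shallow⇒gap {suc (suc zero)}    {zero}  _ _ = inj₂ refl
shallow⇒gap {suc (suc (suc _))} {zero}  _ (s≤s (s≤s ()))
shallow⇒gap {suc r}             {suc c} (s≤s c<r) (s≤s r≤2+c) =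
  Sum.map (cong suc) (cong suc) (shallow⇒gap c<r r≤2+c)

gap⇒shallow : ∀ {r c} → r ≡ c + 1 ⊎ r ≡ c + 2 → r ≤ 2 + c
gap⇒shallow {c = c} (inj₁ refl) = ≤-trans (≤-reflexive (+-comm c 1)) (n≤1+n (1 + c))
gap⇒shallow {c = c} (inj₂ refl) = ≤-reflexive (+-comm c 2)

shallow⇔gap : ∀ {r c} → c < r → r ≤ 2 + c ⇔ (r ≡ c + 1 ⊎ r ≡ c + 2)
shallow⇔gap c<r = mk⇔ (shallow⇒gap c<r) gap⇒shallow

row : ℕ → Parts → ℕ → ℕ
row n μ r = μ (suc n ∸ r)

suc∸∸≡pred : ∀ n r → r ≤ suc n → n ∸ (suc n ∸ r) ≡ r ∸ 1
suc∸∸≡pred n zero    _         = m≤n⇒m∸n≡0 (n≤1+n n)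
suc∸∸≡pred n (suc r) (s≤s r≤n) = m∸[m∸n]≡n r≤n

row-stair : ∀ n d r → r ≤ suc n → row n (stair (n ∸ d)) r ≡ r ∸ suc d
row-stair n d r r≤1+n = begin
  n ∸ d ∸ (suc n ∸ r)    ≡⟨ ∸-+-assoc n d (suc n ∸ r) ⟩
  n ∸ (d + (suc n ∸ r))  ≡⟨ cong (n ∸_) (+-comm d (suc n ∸ r)) ⟩
  n ∸ ((suc n ∸ r) + d)  ≡⟨ ∸-+-assoc n (suc n ∸ r) d ⟨
  n ∸ (suc n ∸ r) ∸ d    ≡⟨ cong (_∸ d) (suc∸∸≡pred n r r≤1+n) ⟩
  r ∸ 1 ∸ d              ≡⟨ ∸-+-assoc r 1 d ⟩
  r ∸ suc d              ∎
  where open ≡-Reasoning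

stair-inStair : ∀ n d → IsPartitionInStair n (stair (n ∸ d))
stair-inStair n d = (λ i _ → ∸-monoʳ-≤ (n ∸ d) (n≤1+n i)) , (λ i _ → ∸-monoˡ-≤ i (m∸n≤m n d))

ShallowCorners : ℕ → Parts → Set
ShallowCorners n μ = ∀ r c → IsCorner n μ r c → r ≤ 2 + c

HasDeepCorner : ℕ → Parts → Set
HasDeepCorner n μ = ∃[ r ] ∃[ c ] IsCorner n μ r c × 2 + c < r

module _ {n : ℕ} {μ : Parts} where

  shallow⇒¬deep : ShallowCorners n μ → ¬ HasDeepCorner n μ
  shallow⇒¬deep shallow (r , c , k , deep) = <⇒≱ deep (shallow r c k)

  incomparable : ∀ {x y} → row n μ y < x → row n μ x < y → Incomparable n μ x y
  incomparable y<x x<y = <⇒≱ y<x , <⇒≱ x<y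

  module _ (P : IsPartitionInStair n μ) where

    antitone : ∀ {i j} → 1 ≤ i → i ≤′ j → μ j ≤ μ i
    antitone _   ≤′-refl        = ≤-refl
    antitone 1≤i (≤′-step i≤′j) =
      ≤-trans (proj₁ P _ (≤-trans 1≤i (≤′⇒≤ i≤′j))) (antitone 1≤i i≤′j)

    row-mono : ∀ {b b'} → b ≤ b' → b' ≤ n → row n μ b ≤ row n μ b'
    row-mono b≤b' b'≤n = antitone (m<n⇒0<n∸m (s≤s b'≤n)) (≤⇒≤′ (∸-monoʳ-≤ (suc n) b≤b'))

    row≤pred : ∀ {b} → b ≤ n → row n μ b ≤ b ∸ 1
    row≤pred {b} b≤n = subst (row n μ b ≤_) (suc∸∸≡pred n b (m≤n⇒m≤1+n b≤n))
                             (proj₂ P (suc n ∸ b) (m<n⇒0<n∸m (s≤s b≤n)))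

    row<self : ∀ {b} → 1 ≤ b → b ≤ n → row n μ b < b
    row<self {suc b} _ b≤n = s≤s (row≤pred b≤n)

    row≤n : ∀ {b} → b ≤ n → row n μ b ≤ n
    row≤n {b} b≤n = ≤-trans (row≤pred b≤n) (≤-trans (m∸n≤m b 1) b≤n)

    -- For r = 1 the cell above lies outside the grid, and row 0 has length μ_{n+1} = 0.
    row-above<col : ∀ {r c} → 1 ≤ r → r ≤ n → 1 ≤ c → c ≤ n →
                    ¬ InShape n μ (r ∸ 1) c → row n μ (r ∸ 1) < c
    row-above<col {suc zero}    _ _   1≤c _   _      = ≤-<-trans (row≤pred z≤n) 1≤c
    row-above<col {suc (suc r)} _ r≤n 1≤c c≤n ¬above =
      ≰⇒> λ c≤row → ¬above ((s≤s z≤n , ≤-trans (n≤1+n _) r≤n) , (1≤c , c≤n) , c≤row)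

    corner⇒ : ∀ {r c} → IsCorner n μ r c →
              InRange n r × c ≡ row n μ r × row n μ (r ∸ 1) < c
    corner⇒ {r} {c} ((r∈@(1≤r , r≤n) , (1≤c , c≤n) , c≤row) , ¬above , ¬right) =
      r∈ , ≤-antisym c≤row (≮⇒≥ c≮row) , row-above<col 1≤r r≤n 1≤c c≤n ¬above
      where
      c≮row : ¬ c < row n μ r
      c≮row c<row = ¬right (r∈ , (s≤s z≤n , ≤-trans c<row (row≤n r≤n)) , c<row)

    corner⇐ : ∀ {r c} → InRange n r → c ≡ row n μ r → row n μ (r ∸ 1) < c → IsCorner n μ r c
    corner⇐ r∈@(_ , r≤n) refl above<c =
      (r∈ , (≤-<-trans z≤n above<c , row≤n r≤n) , ≤-refl)
      , (λ above → <⇒≱ above<c (proj₂ (proj₂ above)))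
      , (λ right → 1+n≰n (proj₂ (proj₂ right)))

    corner⇒col<row : ∀ {r c} → IsCorner n μ r c → c < r
    corner⇒col<row k with corner⇒ k
    ... | (1≤r , r≤n) , refl , _ = row<self 1≤r r≤n

    -- The pattern is c ≺ r together with r − 2 and r − 1: the rows r − 2, r − 1 and c are
    -- shorter than c, row r is c, and c lies below r − 2, r − 1 and r.
    deepCorner⇒¬avoids : ∀ {r c} → IsCorner n μ r c → 2 + c < r → ¬ Avoids2+1+1 n μ
    deepCorner⇒¬avoids {c = c} k@((_ , (1≤c , c≤n) , _) , _) (s≤s (s≤s (s≤s {n = q} c≤q))) avoids =
      avoids ( c , 3 + q , 1 + q , 2 + q
             , ((1≤c , c≤n) , (s≤s z≤n , r≤n) , (s≤s z≤n , x≤n) , (s≤s z≤n , y≤n))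
             , (<⇒≢ c<r , <⇒≢ c<x , <⇒≢ c<y , (λ ()) , (λ ()) , (λ ()))
             , ≤-reflexive c≡row
             , incomparable (sep (2 + q) rowY≤c c<x) (sep (1 + q) rowX≤c c<y)
             , incomparable (sep c (<⇒≤ rowC<c) c<x) rowX<c
             , incomparable (sep (3 + q) (≤-reflexive (sym c≡row)) c<x) (sep (1 + q) rowX≤c c<r)
             , incomparable (sep c (<⇒≤ rowC<c) c<y) rowY<c
             , incomparable (sep (3 + q) (≤-reflexive (sym c≡row)) c<y) (sep (2 + q) rowY≤c c<r) )
      where
      r≤n : 3 + q ≤ n
      r≤n = proj₂ (proj₁ (corner⇒ k))
      c≡row : c ≡ row n μ (3 + q)
      c≡row = proj₁ (proj₂ (corner⇒ k))
      rowY<c : row n μ (2 + q) < c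
      rowY<c = proj₂ (proj₂ (corner⇒ k))
      y≤n : 2 + q ≤ n
      y≤n = ≤-trans (n≤1+n _) r≤n
      x≤n : 1 + q ≤ n
      x≤n = ≤-trans (n≤1+n _) y≤n
      rowX<c : row n μ (1 + q) < c
      rowX<c = ≤-<-trans (row-mono (n≤1+n _) y≤n) rowY<c
      rowC<c : row n μ c < c
      rowC<c = row<self 1≤c c≤n
      rowX≤c : row n μ (1 + q) ≤ c
      rowX≤c = <⇒≤ rowX<c
      rowY≤c : row n μ (2 + q) ≤ c
      rowY≤c = <⇒≤ rowY<c
      c<x : c < 1 + q
      c<x = s≤s c≤q
      c<y : c < 2 + q
      c<y = m<n⇒m<1+n c<x
      c<r : c < 3 + q
      c<r = m<n⇒m<1+n c<y
      sep : ∀ u {v} → row n μ u ≤ c → c < v → row n μ u < v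
      sep _ = ≤-<-trans

    -- The corner sits where the row length first reaches a, between rows x and b.
    deepCornerBetween : ∀ {a b x y} → b ≤ n → x ≤ n → y < x →
                        row n μ x < a → a ≤ row n μ b → row n μ b < y →
                        HasDeepCorner n μ
    deepCornerBetween {b = b} {x = x} b≤n x≤n y<x rowX<a a≤rowB rowB<y
      with crossing (row n μ) x<b rowX<a a≤rowB
      where
      x<b : x < b
      x<b = ≰⇒> λ b≤x → <⇒≱ (<-≤-trans rowX<a a≤rowB) (row-mono b≤x x≤n)
    ... | r , x≤r , r<b , rowR<a , a≤row[1+r] =
      suc r , row n μ (suc r)
      , corner⇐ (s≤s z≤n , ≤-trans r<b b≤n) refl (<-≤-trans rowR<a a≤row[1+r])
      , s≤s (≤-trans (s≤s (≤-<-trans (row-mono r<b b≤n) rowB<y)) (≤-trans y<x x≤r))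

    avoids⇔shallowCorners : Avoids2+1+1 n μ ⇔ ShallowCorners n μ
    avoids⇔shallowCorners = mk⇔ avoids⇒shallow shallow⇒avoids
      where
      avoids⇒shallow : Avoids2+1+1 n μ → ShallowCorners n μ
      avoids⇒shallow avoids r c k =
        decidable-stable (r ≤? 2 + c) λ r≰2+c → deepCorner⇒¬avoids k (≰⇒> r≰2+c) avoids

      shallow⇒avoids : ShallowCorners n μ → Avoids2+1+1 n μ
      shallow⇒avoids shallow
        (a , b , c , d , (_ , (_ , b≤n) , (_ , c≤n) , (_ , d≤n)) , (_ , _ , _ , _ , _ , c≢d) ,
         a≺b , _ , c∥a , c∥b , d∥a , d∥b) with <-cmp c d
      ... | tri< c<d _ _ = shallow⇒¬deep shallow
                             (deepCornerBetween b≤n d≤n c<d (≰⇒> (proj₂ d∥a)) a≺b (≰⇒> (proj₁ c∥b)))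
      ... | tri≈ _ c≡d _ = c≢d c≡d
      ... | tri> _ _ d<c = shallow⇒¬deep shallow
                             (deepCornerBetween b≤n c≤n d<c (≰⇒> (proj₂ c∥a)) a≺b (≰⇒> (proj₁ d∥b)))

stairCorner⇒ : ∀ {n r c} d → IsCorner n (stair (n ∸ d)) r c → r ≡ c + suc d
stairCorner⇒ {n} {r} {c} d k with corner⇒ (stair-inStair n d) k
... | (_ , r≤n) , c≡row , above<c = begin
  r                  ≡⟨ m∸n+n≡m {n = suc d} (<⇒≤ (m∸n≢0⇒n<m r∸[1+d]≢0)) ⟨
  r ∸ suc d + suc d  ≡⟨ cong (_+ suc d) c≡r∸[1+d] ⟨
  c + suc d          ∎
  where
  open ≡-Reasoning
  c≡r∸[1+d] : c ≡ r ∸ suc d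
  c≡r∸[1+d] = trans c≡row (row-stair n d r (m≤n⇒m≤1+n r≤n))
  r∸[1+d]≢0 : r ∸ suc d ≢ 0
  r∸[1+d]≢0 r∸[1+d]≡0 = <⇒≢ (≤-<-trans z≤n above<c) (sym (trans c≡r∸[1+d] r∸[1+d]≡0))

stairCorner⇐ : ∀ {n c} d → 1 ≤ c → c + suc d ≤ n → IsCorner n (stair (n ∸ d)) (c + suc d) c
stairCorner⇐ {n} {suc c} d _ r≤n =
  corner⇐ (stair-inStair n d) (s≤s z≤n , r≤n) (sym row-r≡c) (≤-<-trans (≤-reflexive row-above≡c-1) (n<1+n c))
  where
  row-r≡c : row n (stair (n ∸ d)) (suc c + suc d) ≡ suc c
  row-r≡c = trans (row-stair n d (suc c + suc d) (m≤n⇒m≤1+n r≤n)) (m+n∸n≡m (suc c) (suc d))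
  row-above≡c-1 : row n (stair (n ∸ d)) (c + suc d) ≡ c
  row-above≡c-1 = trans (row-stair n d (c + suc d) (≤-trans (n≤1+n _) (m≤n⇒m≤1+n r≤n))) (m+n∸n≡m c (suc d))

stairCorners⇔gap : ∀ {n r c} → 1 ≤ c → r ≤ n →
  (IsCorner n (stair (n ∸ 1)) r c ⊎ IsCorner n (stair n) r c) ⇔ (r ≡ c + 1 ⊎ r ≡ c + 2)
stairCorners⇔gap 1≤c r≤n =
  mk⇔ (swap ∘ Sum.map (stairCorner⇒ 1) (stairCorner⇒ 0)) (gap⇒stairCorner 1≤c r≤n)
  where
  gap⇒stairCorner : ∀ {n r c} → 1 ≤ c → r ≤ n → r ≡ c + 1 ⊎ r ≡ c + 2 →
                    IsCorner n (stair (n ∸ 1)) r c ⊎ IsCorner n (stair n) r c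
  gap⇒stairCorner 1≤c r≤n (inj₁ refl) = inj₂ (stairCorner⇐ 0 1≤c r≤n)
  gap⇒stairCorner 1≤c r≤n (inj₂ refl) = inj₁ (stairCorner⇐ 1 1≤c r≤n)

lemma2p8 : (n : ℕ) → 1 ≤ n → (μ : Parts) → IsPartitionInStair n μ →
    (Avoids2+1+1 n μ ⇔
      (∀ r c → IsCorner n μ r c →
        IsCorner n (stair (n ∸ 1)) r c ⊎ IsCorner n (stair n) r c))
    × (Avoids2+1+1 n μ ⇔
      (∀ r c → IsCorner n μ r c → (r ≡ c + 1) ⊎ (r ≡ c + 2)))
lemma2p8 n _ μ P = ⇔.trans avoids⇔gaps (guarded-∀-cong (⇔.sym ∘ gaps⇔stairCorners)) , avoids⇔gaps
  where
  avoids⇔gaps : Avoids2+1+1 n μ ⇔ (∀ r c → IsCorner n μ r c → r ≡ c + 1 ⊎ r ≡ c + 2)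
  avoids⇔gaps = ⇔.trans (avoids⇔shallowCorners P) (guarded-∀-cong (shallow⇔gap ∘ corner⇒col<row P))

  gaps⇔stairCorners : ∀ {r c} → IsCorner n μ r c →
    (IsCorner n (stair (n ∸ 1)) r c ⊎ IsCorner n (stair n) r c) ⇔ (r ≡ c + 1 ⊎ r ≡ c + 2)
  gaps⇔stairCorners ((( _ , r≤n) , (1≤c , _) , _) , _) = stairCorners⇔gap 1≤c r≤n
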